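{- Let $a,b$ be coprime positive integers and fix $k$ with $0\le k<b$. Every coset of $K$ in $\mathbb{Z}^b$ contains exactly one $k$-skeletal chip configuration.
   Context: Write $[b]=\{1,\dots,b\}$; chip configurations are vectors $D\in\mathbb{Z}^b$, and $D\ge0$ means all entries nonnegative. For $S\subseteq[b]$ with $|S|=s$, $\phi_S$ subtracts $1+\lfloor (b-s)a/b\rfloor$ from $D(i)$ for $i\in S$ and adds $\lfloor sa/b\rfloor$ to $D(j)$ for $j\in[b]\setminus S$; $\beta_S=\phi_S^{ -1}$; for $D\ge0$ a move is legal if its result is $\ge0$. A $k$-firing move is $\phi_S$ with $0<|S|\le k+1$; $D\ge 0$ is $k$-stable if no $k$-firing move is legal on $D$; $D$ is $k$-skeletal if it is $k$-stable and for every nonempty $T$ with $\beta_T$ legal on $D$, $\beta_T(D)$ is not $k$-stable. $K$ is the subgroup of $\mathbb{Z}^b$ generated by $a\mathbf{e}_1,\dots,a\mathbf{e}_b$ and $\mathbf{1}=(1,\dots,1)$. -}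

module Defs where

open import Data.Nat as ℕ using (ℕ; NonZero; _∸_; _/_)
open import Data.Integer as ℤ using (ℤ; +_; 0ℤ)
open import Data.Fin using (Fin)
open import Data.Fin.Subset using (Subset; ∣_∣)
open import Data.Vec using (lookup)
open import Data.Bool using (if_then_else_)
open import Data.Product using (Σ; _×_)
open import Relation.Nullary using (¬_)
open import Relation.Binary.PropositionalEquality using (_≡_)

Config : ℕ → Set
Config b = Fin b → ℤ

NonNeg : ∀ {b} → Config b → Set
NonNeg D = ∀ i → 0ℤ ℤ.≤ D i

module _ (a b : ℕ) .{{_ : NonZero b}} where

  -- amount lost by each vertex of S (|S| = s) : 1 + ⌊(b-s)a/b⌋
  loss : ℕ → ℕ
  loss s = ℕ.suc (((b ∸ s) ℕ.* a) / b)

  -- amount gained by each vertex outside S : ⌊sa/b⌋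
  gain : ℕ → ℕ
  gain s = (s ℕ.* a) / b

  φ : Subset b → Config b → Config b
  φ S D i = if lookup S i
              then D i ℤ.- + loss ∣ S ∣
              else D i ℤ.+ + gain ∣ S ∣

  -- β_S = φ_S⁻¹ (φ_S is a translation; β_S is the opposite translation)
  β : Subset b → Config b → Config b
  β S D i = if lookup S i
              then D i ℤ.+ + loss ∣ S ∣
              else D i ℤ.- + gain ∣ S ∣

  kStable : ℕ → Config b → Set
  kStable k D = NonNeg D ×
    (∀ (S : Subset b) → 0 ℕ.< ∣ S ∣ → ∣ S ∣ ℕ.≤ ℕ.suc k → ¬ NonNeg (φ S D))

  kSkeletal : ℕ → Config b → Set
  kSkeletal k D = kStable k D ×
    (∀ (T : Subset b) → 0 ℕ.< ∣ T ∣ → NonNeg (β T D) → ¬ kStable k (β T D))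

-- K = subgroup of ℤ^b generated by a·e_1,…,a·e_b and 𝟏
InK : (a : ℕ) {b : ℕ} → Config b → Set
InK a {b} v = Σ (Config b) λ x → Σ ℤ λ c → ∀ i → v i ≡ + a ℤ.* x i ℤ.+ c

SameCoset : (a : ℕ) {b : ℕ} → Config b → Config b → Set
SameCoset a D E = InK a (λ i → D i ℤ.- E i)

module Submission where

-- Reducing D entrywise modulo a gives a configuration B with entries in [0, a). The configurations of
-- the coset of D with entries in [0, a) are exactly the shifts of B (subtract m from every entry modulo a,
-- 0 ≤ m < a), and every k-stable configuration has its entries in [0, a).
-- A shift of least total is k-stable; let E be a k-stable shift of greatest total. A reverse firing stays
-- in the coset and strictly increases the total, so it never leads from E to a k-stable configuration:
-- E is k-skeletal.
-- Conversely, let the shift of E by m₀ ∈ (0, a) be k-stable. Since a and b are coprime its total is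
-- strictly smaller than that of E. The first m whose shift has total at most b more than it is minimal
-- among the shifts by 0, …, m, which keeps the shift by m k-stable, and comparing the two shifts entry by
-- entry shows that the shift by m is a reverse firing of the shift by m₀. So the latter is not k-skeletal.

open import Defs
open import Data.Nat using (ℕ; NonZero; _<_)
open import Data.Nat.Coprimality using (Coprime)
open import Data.Product using (Σ; _×_)
open import Relation.Binary.PropositionalEquality using (_≡_)

open import Algebra.Properties.CommutativeSemigroup using (interchange; xy∙z≈xz∙y)
open import Data.Bool using (true; false)
open import Data.Empty using (⊥; ⊥-elim)
open import Data.Fin using (Fin; zero; suc)
import Data.Fin.Subset as Subset
open import Data.Fin.Subset using (Subset; ∣_∣; _∈_; _∉_; _⊆_; ∁; _∪_; _─_)
open import Data.Fin.Subset.Properties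
  using (_∈?_; ∈⊤; ⊥⊆; drop-there; drop-∷-⊆; out⊆; in⊆in; x∉p⇒x∈∁p; x∈∁p⇒x∉p; x∈p∪q⁺; x∈p∧x∉q⇒x∈p─q;
         ∣⊥∣≡0; ∣p∣≤n; ∣p∣≤∣x∷p∣; ∣∁p∣≡n∸∣p∣; ∣p∣≡n⇒p≡⊤; x∈p⇒∣p-x∣<∣p∣; p⊆q⇒∣p∣≤∣q∣)
open import Data.Integer as ℤ using (-[1+_]; 0ℤ; -1ℤ; +≤+; _⊖_)
import Data.Integer.Properties as ℤ
open import Data.Integer.Tactic.RingSolver using () renaming (solve-∀ to ℤ-solve-∀)
open import Data.List using (List; upTo; filter)
open import Data.List.Extrema.Nat using (argmin; argmax; argmin-all; argmax-all; f[argmin]≤f[xs]; f[xs]≤f[argmax])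
open import Data.List.Membership.Propositional.Properties using (∈-upTo⁺; ∈-upTo⁻; ∈-filter⁺)
import Data.List.Relation.Unary.All as All
open import Data.List.Relation.Unary.All.Properties using (all-filter)
open import Data.Nat
import Data.Nat.Coprimality as Coprimality
open import Data.Nat.Coprimality using (coprime-divisor)
open import Data.Nat.Divisibility using (_∣_; divides; ∣⇒≤)
open import Data.Nat.DivMod using (_/_; _%_; 0/n≡0; m%n<n; m/n*n≤m; m≡m%n+[m/n]*n; m<n*o⇒m/o<n)
open import Data.Nat.Properties
open import Data.Nat.Tactic.RingSolver using (solve-∀)
open import Data.Product using (∃-syntax; _,_; proj₁; proj₂)
open import Data.Sum using (_⊎_; inj₁; inj₂)
open import Data.Vec using ([]; _∷_; here; there; tabulate; lookup)
open import Data.Vec.Properties using (lookup∘tabulate; lookup⇒[]=; []=⇒lookup; tabulate-cong)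
open import Function using (_∘_)
open import Relation.Binary.PropositionalEquality
  using (_≢_; _≗_; refl; sym; trans; cong; cong₂; subst; module ≡-Reasoning)
open import Relation.Nullary using (Dec; yes; no; does; ¬_; contradiction)
open import Relation.Nullary.Decidable using (dec-true; map′; _→-dec_; _×-dec_)

open import Algebra.Properties.CommutativeMonoid.Sum +-0-commutativeMonoid using (sum; ∑-distrib-+; sum-cong-≗)

-- Arithmetic and search on ℕ

+-interchange : ∀ w x y z → (w + x) + (y + z) ≡ (w + y) + (x + z)
+-interchange = interchange +-commutativeSemigroup

+-rightComm : ∀ x y z → x + y + z ≡ x + z + y
+-rightComm = xy∙z≈xz∙y +-commutativeSemigroup

[n∸m]*x+m*x≡n*x : ∀ {m n} x → m ≤ n → (n ∸ m) * x + m * x ≡ n * x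
[n∸m]*x+m*x≡n*x {m} {n} x m≤n = trans (sym (*-distribʳ-+ x (n ∸ m) m)) (cong (_* x) (m∸n+n≡m m≤n))

u≡v+a*j⇒u≡v : ∀ {a u v j} → u < a → u ≡ v + a * j → u ≡ v
u≡v+a*j⇒u≡v {a} {u} {v} {zero}  _   u≡v+a*0 = trans u≡v+a*0 (trans (cong (v +_) (*-zeroʳ a)) (+-identityʳ v))
u≡v+a*j⇒u≡v {a} {u} {v} {suc j} u<a u≡v+a*j =
  contradiction (≤-trans (m≤m*n a (suc j)) (≤-trans (m≤n+m _ v) (≤-reflexive (sym u≡v+a*j)))) (<⇒≱ u<a)

module _ {d : ℕ} .{{_ : NonZero d}} where

  d*[m/d]≤m : ∀ m → d * (m / d) ≤ m
  d*[m/d]≤m m = subst (_≤ m) (*-comm (m / d) d) (m/n*n≤m m d)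

  m<d*[m/d]+d : ∀ m → m < d * (m / d) + d
  m<d*[m/d]+d m = begin-strict
    m                   ≡⟨ m≡m%n+[m/n]*n m d ⟩
    m % d + m / d * d   <⟨ +-monoˡ-< (m / d * d) (m%n<n m d) ⟩
    d + m / d * d       ≡⟨ cong (d +_) (*-comm (m / d) d) ⟩
    d + d * (m / d)     ≡⟨ +-comm d _ ⟩
    d * (m / d) + d     ∎
    where open ≤-Reasoning

  [m/d]≡q : ∀ {m q} → d * q ≤ m → m < d * q + d → m / d ≡ q
  [m/d]≡q {m} {q} dq≤m m<dq+d = ≤-antisym (s≤s⁻¹ (*-cancelˡ-< d _ _ upper)) (s≤s⁻¹ (*-cancelˡ-< d _ _ lower))
    where
    open ≤-Reasoning
    upper : d * (m / d) < d * suc q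
    upper = begin-strict
      d * (m / d)   ≤⟨ d*[m/d]≤m m ⟩
      m             <⟨ m<dq+d ⟩
      d * q + d     ≡⟨ trans (+-comm _ d) (sym (*-suc d q)) ⟩
      d * suc q     ∎
    lower : d * q < d * suc (m / d)
    lower = begin-strict
      d * q             ≤⟨ dq≤m ⟩
      m                 <⟨ m<d*[m/d]+d m ⟩
      d * (m / d) + d   ≡⟨ trans (+-comm _ d) (sym (*-suc d (m / d))) ⟩
      d * suc (m / d)   ∎

least : ∀ {P : ℕ → Set} → (∀ n → Dec (P n)) → ∀ {n} → P n → ∃[ m ] m ≤ n × P m × (∀ {z} → z < m → ¬ P z)
least P? {zero}  P0 = zero , z≤n , P0 , λ ()
least {P} P? {suc n} P[1+n] with P? zero
... | yes P0  = zero , z≤n , P0 , λ ()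
... | no ¬P0 with least {P = λ z → P (suc z)} (λ z → P? (suc z)) P[1+n]
...   | m , m≤n , Pm , none-below = suc m , s≤s m≤n , Pm , none-below′
  where
  none-below′ : ∀ {z} → z < suc m → ¬ P z
  none-below′ {zero}  _         = ¬P0
  none-below′ {suc z} (s≤s z<m) = none-below z<m

module _ (f : ℕ → ℕ) where

  -- Opaque, so that type checking never tries to evaluate these searches on open terms.
  opaque
    argmin-upTo : ∀ n → ∃[ m ] m ≤ n × (∀ {z} → z ≤ n → f m ≤ f z)
    argmin-upTo n = argmin f 0 (upTo (suc n)) ,
      s≤s⁻¹ (argmin-all f {P = _< suc n} z<s (All.tabulate ∈-upTo⁻)) ,
      λ z≤n → All.lookup (f[argmin]≤f[xs] {f = f} 0 (upTo (suc n))) (∈-upTo⁺ (s≤s z≤n))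

    argmax-upTo : ∀ {P : ℕ → Set} → (∀ z → Dec (P z)) → ∀ n {d} → P d → ∃[ m ] P m × (∀ {z} → z < n → P z → f z ≤ f m)
    argmax-upTo P? n {d} Pd = argmax f d candidates , argmax-all f Pd (all-filter P? (upTo n)) ,
      λ z<n Pz → All.lookup (f[xs]≤f[argmax] {f = f} d candidates) (∈-filter⁺ P? (∈-upTo⁺ z<n) Pz)
      where
      candidates : List ℕ
      candidates = filter P? (upTo n)

-- Counting in subsets

module _ {n : ℕ} {P : Fin n → Set} (P? : ∀ i → Dec (P i)) where

  subset : Subset n
  subset = tabulate (λ i → does (P? i))

  ∈-subset⁺ : ∀ {i} → P i → i ∈ subset
  ∈-subset⁺ {i} Pi = lookup⇒[]= i subset (trans (lookup∘tabulate _ i) (dec-true (P? i) Pi))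

  ∈-subset⁻ : ∀ {i} → i ∈ subset → P i
  ∈-subset⁻ {i} i∈ with P? i | trans (sym (lookup∘tabulate (λ j → does (P? j)) i)) ([]=⇒lookup i∈)
  ... | yes Pi | _ = Pi
  ... | no _   | ()

∣p∪q∣≤∣p∣+∣q∣ : ∀ {n} (p q : Subset n) → ∣ p ∪ q ∣ ≤ ∣ p ∣ + ∣ q ∣
∣p∪q∣≤∣p∣+∣q∣ []          []          = z≤n
∣p∪q∣≤∣p∣+∣q∣ (true  ∷ p) (x ∷ q)     = s≤s (≤-trans (∣p∪q∣≤∣p∣+∣q∣ p q) (+-monoʳ-≤ ∣ p ∣ (∣p∣≤∣x∷p∣ x q)))
∣p∪q∣≤∣p∣+∣q∣ (false ∷ p) (true  ∷ q) = ≤-trans (s≤s (∣p∪q∣≤∣p∣+∣q∣ p q)) (≤-reflexive (sym (+-suc ∣ p ∣ ∣ q ∣)))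
∣p∪q∣≤∣p∣+∣q∣ (false ∷ p) (false ∷ q) = ∣p∪q∣≤∣p∣+∣q∣ p q

∣p─q∣+∣q∣≡∣p∣ : ∀ {n} {p q : Subset n} → q ⊆ p → ∣ p ─ q ∣ + ∣ q ∣ ≡ ∣ p ∣
∣p─q∣+∣q∣≡∣p∣ {p = []}     {[]}        _   = refl
∣p─q∣+∣q∣≡∣p∣ {p = x ∷ p}  {true ∷ q}  q⊆p with q⊆p here
... | here = trans (+-suc ∣ p ─ q ∣ ∣ q ∣) (cong suc (∣p─q∣+∣q∣≡∣p∣ (drop-∷-⊆ q⊆p)))
∣p─q∣+∣q∣≡∣p∣ {p = true  ∷ p} {false ∷ q} q⊆p = cong suc (∣p─q∣+∣q∣≡∣p∣ (drop-∷-⊆ q⊆p))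
∣p─q∣+∣q∣≡∣p∣ {p = false ∷ p} {false ∷ q} q⊆p = ∣p─q∣+∣q∣≡∣p∣ (drop-∷-⊆ q⊆p)

∃⊆-of-size : ∀ {n s} (p : Subset n) → s ≤ ∣ p ∣ → ∃[ q ] q ⊆ p × ∣ q ∣ ≡ s
∃⊆-of-size {n} {zero} p _ = Subset.⊥ , ⊥⊆ , ∣⊥∣≡0 n
∃⊆-of-size {s = suc s} (true ∷ p) (s≤s s≤∣p∣) with ∃⊆-of-size p s≤∣p∣
... | q , q⊆p , ∣q∣≡s = true ∷ q , in⊆in q⊆p , cong suc ∣q∣≡s
∃⊆-of-size {s = suc s} (false ∷ p) s<∣p∣ with ∃⊆-of-size p s<∣p∣
... | q , q⊆p , ∣q∣≡s = false ∷ q , out⊆ q⊆p , ∣q∣≡s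

∣p∣+∣∁p∣≡n : ∀ {n} (p : Subset n) → ∣ p ∣ + ∣ ∁ p ∣ ≡ n
∣p∣+∣∁p∣≡n p = trans (cong (∣ p ∣ +_) (∣∁p∣≡n∸∣p∣ p)) (m+[n∸m]≡n (∣p∣≤n p))

x∈p⇒0<∣p∣ : ∀ {n} {p : Subset n} {x} → x ∈ p → 0 < ∣ p ∣
x∈p⇒0<∣p∣ x∈p = ≤-<-trans z≤n (x∈p⇒∣p-x∣<∣p∣ x∈p)

x∉p⇒∣p∣<n : ∀ {n} {p : Subset n} {x} → x ∉ p → ∣ p ∣ < n
x∉p⇒∣p∣<n {p = p} {x} x∉p = ≤∧≢⇒< (∣p∣≤n p) (λ ∣p∣≡n → x∉p (subst (x ∈_) (sym (∣p∣≡n⇒p≡⊤ ∣p∣≡n)) ∈⊤))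

sum-split : ∀ {n} (p : Subset n) {f g : Fin n → ℕ} {x y : ℕ} →
            (∀ {i} → i ∈ p → f i ≡ g i + x) → (∀ {i} → i ∉ p → f i + y ≡ g i) →
            sum f + ∣ ∁ p ∣ * y ≡ sum g + ∣ p ∣ * x
sum-split []         on off = refl
sum-split (true ∷ p) {f} {g} {x} {y} on off = begin
  f zero + sum (f ∘ suc) + ∣ ∁ p ∣ * y     ≡⟨ +-assoc (f zero) _ _ ⟩
  f zero + (sum (f ∘ suc) + ∣ ∁ p ∣ * y)   ≡⟨ cong₂ _+_ (on here) (sum-split p (on ∘ there) (λ i∉p → off (i∉p ∘ drop-there))) ⟩
  g zero + x + (sum (g ∘ suc) + ∣ p ∣ * x) ≡⟨ +-interchange (g zero) x _ _ ⟩
  g zero + sum (g ∘ suc) + (x + ∣ p ∣ * x) ∎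
  where open ≡-Reasoning
sum-split (false ∷ p) {f} {g} {x} {y} on off = begin
  f zero + sum (f ∘ suc) + (y + ∣ ∁ p ∣ * y) ≡⟨ +-interchange (f zero) _ y _ ⟩
  f zero + y + (sum (f ∘ suc) + ∣ ∁ p ∣ * y) ≡⟨ cong₂ _+_ (off λ ()) (sum-split p (on ∘ there) (λ i∉p → off (i∉p ∘ drop-there))) ⟩
  g zero + (sum (g ∘ suc) + ∣ p ∣ * x)       ≡⟨ +-assoc (g zero) _ _ ⟨
  g zero + sum (g ∘ suc) + ∣ p ∣ * x         ∎
  where open ≡-Reasoning

sum-const : ∀ n x → sum {n} (λ _ → x) ≡ n * x
sum-const zero    x = refl
sum-const (suc n) x = cong (x +_) (sum-const n x)

-- The firing amounts loss and gain

module _ (a b : ℕ) .{{_ : NonZero b}} where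

  -- loss s is the least ℓ with b ℓ + s a > b a.
  b*a<b*loss+s*a : ∀ {s} → s ≤ b → b * a < b * loss a b s + s * a
  b*a<b*loss+s*a {s} s≤b = begin-strict
    b * a                 ≡⟨ [n∸m]*x+m*x≡n*x a s≤b ⟨
    (b ∸ s) * a + s * a   <⟨ +-monoˡ-< (s * a) (m<d*[m/d]+d ((b ∸ s) * a)) ⟩
    b * q + b + s * a     ≡⟨ cong (_+ s * a) (trans (+-comm _ b) (sym (*-suc b q))) ⟩
    b * suc q + s * a     ∎
    where
    open ≤-Reasoning
    q = (b ∸ s) * a / b

  b*ℓ+s*a≤b*a : ∀ {s ℓ} → s ≤ b → ℓ < loss a b s → b * ℓ + s * a ≤ b * a
  b*ℓ+s*a≤b*a {s} {ℓ} s≤b ℓ<loss = begin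
    b * ℓ + s * a                   ≤⟨ +-monoˡ-≤ (s * a) (*-monoʳ-≤ b (s≤s⁻¹ ℓ<loss)) ⟩
    b * ((b ∸ s) * a / b) + s * a   ≤⟨ +-monoˡ-≤ (s * a) (d*[m/d]≤m ((b ∸ s) * a)) ⟩
    (b ∸ s) * a + s * a             ≡⟨ [n∸m]*x+m*x≡n*x a s≤b ⟩
    b * a                           ∎
    where open ≤-Reasoning

  loss-b≡1 : loss a b b ≡ 1
  loss-b≡1 = cong suc (trans (cong (λ x → x * a / b) (n∸n≡0 b)) (0/n≡0 b))

  loss≤a : ∀ {s} → 0 < a → 0 < s → s ≤ b → loss a b s ≤ a
  loss≤a {s} 0<a 0<s s≤b = m<n*o⇒m/o<n (subst ((b ∸ s) * a <_) (*-comm b a) [b∸s]*a<b*a)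
    where
    [b∸s]*a<b*a : (b ∸ s) * a < b * a
    [b∸s]*a<b*a = *-monoˡ-< a {{>-nonZero 0<a}} (∸-monoʳ-< 0<s s≤b)

module _ {a b : ℕ} .{{_ : NonZero b}} (coprime : Coprime a b) where

  b∤t*a : ∀ {t} → 0 < t → t < b → ¬ b ∣ t * a
  b∤t*a {t} 0<t t<b b∣t*a =
    <⇒≱ t<b (∣⇒≤ {{>-nonZero 0<t}} (coprime-divisor (Coprimality.sym coprime) (subst (b ∣_) (*-comm t a) b∣t*a)))

  b*gain<t*a : ∀ {t} → 0 < t → t < b → b * gain a b t < t * a
  b*gain<t*a {t} 0<t t<b =
    ≤∧≢⇒< (d*[m/d]≤m (t * a)) (λ eq → b∤t*a 0<t t<b (divides (gain a b t) (trans (sym eq) (*-comm b _))))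

  loss+gain≡a : ∀ {t} → 0 < t → t < b → loss a b t + gain a b t ≡ a
  loss+gain≡a {t} 0<t t<b = ≤-antisym (*-cancelˡ-< b _ _ upper) (s≤s⁻¹ (*-cancelˡ-< b _ _ lower))
    where
    open ≤-Reasoning
    L = loss a b t
    G = gain a b t
    q = (b ∸ t) * a / b
    upper : b * (q + G) < b * a
    upper = begin-strict
      b * (q + G)     ≡⟨ *-distribˡ-+ b q G ⟩
      b * q + b * G   <⟨ +-monoʳ-< (b * q) (b*gain<t*a 0<t t<b) ⟩
      b * q + t * a   ≤⟨ b*ℓ+s*a≤b*a a b (<⇒≤ t<b) ≤-refl ⟩
      b * a           ∎
    regroup : ∀ x y z → x * y + (x * z + x) ≡ x * suc (y + z)
    regroup = solve-∀
    lower : b * a < b * suc (L + G)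
    lower = begin-strict
      b * a               <⟨ b*a<b*loss+s*a a b (<⇒≤ t<b) ⟩
      b * L + t * a       <⟨ +-monoʳ-< (b * L) (m<d*[m/d]+d (t * a)) ⟩
      b * L + (b * G + b) ≡⟨ regroup b L G ⟩
      b * suc (L + G)     ∎

  [b∸t]*gain<t*loss : ∀ {t} → 0 < t → t ≤ b → (b ∸ t) * gain a b t < t * loss a b t
  [b∸t]*gain<t*loss {t} 0<t t≤b with m≤n⇒m<n∨m≡n t≤b
  ... | inj₁ t<b = +-cancelʳ-< (t * G) _ _ (begin-strict
    (b ∸ t) * G + t * G   ≡⟨ [n∸m]*x+m*x≡n*x G t≤b ⟩
    b * G                 <⟨ b*gain<t*a 0<t t<b ⟩
    t * a                 ≡⟨ cong (t *_) (loss+gain≡a 0<t t<b) ⟨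
    t * (L + G)           ≡⟨ *-distribˡ-+ t L G ⟩
    t * L + t * G         ∎)
    where
    open ≤-Reasoning
    L = loss a b t
    G = gain a b t
  ... | inj₂ t≡b = begin-strict
    (b ∸ t) * gain a b t  ≡⟨ cong (λ x → (b ∸ x) * gain a b t) t≡b ⟩
    (b ∸ b) * gain a b t  ≡⟨ cong (_* gain a b t) (n∸n≡0 b) ⟩
    0                     <⟨ >-nonZero⁻¹ b ⟩
    b                     ≡⟨ *-identityʳ b ⟨
    b * 1                 ≡⟨ cong₂ _*_ (sym t≡b) (sym (loss-b≡1 a b)) ⟩
    t * loss a b b        ≡⟨ cong (λ x → t * loss a b x) t≡b ⟨
    t * loss a b t        ∎
    where open ≤-Reasoning

  a*m≢b*n : ∀ {m n} → 0 < n → n < a → a * m ≢ b * n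
  a*m≢b*n {m} {n} 0<n n<a eq =
    <⇒≱ n<a (∣⇒≤ {{>-nonZero 0<n}} (coprime-divisor coprime (divides m (trans (sym eq) (*-comm a m)))))

  gain-unique : ∀ {t g} → 0 < t → t < b → b * g < t * a → t * a ≤ b * g + b → gain a b t ≡ g
  gain-unique {t} {g} 0<t t<b b*g<t*a t*a≤b*g+b = [m/d]≡q (<⇒≤ b*g<t*a) (≤∧≢⇒< t*a≤b*g+b t*a≢b*g+b)
    where
    t*a≢b*g+b : t * a ≢ b * g + b
    t*a≢b*g+b eq = b∤t*a 0<t t<b (divides (suc g) (trans eq (trans (+-comm (b * g) b) (trans (sym (*-suc b g)) (*-comm b (suc g))))))

  loss-unique : ∀ {t r g} → 0 < t → t ≤ b → r + g ≡ a → b * g < t * a → t * a ≤ b * g + b → loss a b t ≡ r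
  loss-unique {t} {r} {g} 0<t t≤b r+g≡a b*g<t*a t*a≤b*g+b with m≤n⇒m<n∨m≡n t≤b
  ... | inj₁ t<b = +-cancelʳ-≡ g _ _ (begin
    loss a b t + g           ≡⟨ cong (loss a b t +_) (gain-unique 0<t t<b b*g<t*a t*a≤b*g+b) ⟨
    loss a b t + gain a b t  ≡⟨ loss+gain≡a 0<t t<b ⟩
    a                        ≡⟨ r+g≡a ⟨
    r + g                    ∎)
    where open ≡-Reasoning
  ... | inj₂ t≡b = trans (cong (loss a b) t≡b) (trans (loss-b≡1 a b) (sym r≡1))
    where
    open ≤-Reasoning
    b*a≡t*a : b * a ≡ t * a
    b*a≡t*a = cong (_* a) (sym t≡b)
    g<a : g < a
    g<a = *-cancelˡ-< b _ _ (subst (b * g <_) (sym b*a≡t*a) b*g<t*a)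
    a≤1+g : a ≤ suc g
    a≤1+g = *-cancelˡ-≤ b (begin
      b * a       ≡⟨ b*a≡t*a ⟩
      t * a       ≤⟨ t*a≤b*g+b ⟩
      b * g + b   ≡⟨ +-comm (b * g) b ⟩
      b + b * g   ≡⟨ *-suc b g ⟨
      b * suc g   ∎)
    r≡1 : r ≡ 1
    r≡1 = +-cancelʳ-≡ g r 1 (trans r+g≡a (≤-antisym a≤1+g g<a))

  reverse-firing-amounts : ∀ {t u r g} → t + u ≡ b → r + g ≡ a → u * g < t * r → t * r ≤ u * g + b →
                           0 < t × loss a b t ≡ r × (t < b → gain a b t ≡ g)
  reverse-firing-amounts {t} {u} {r} {g} t+u≡b r+g≡a u*g<t*r t*r≤u*g+b =
    0<t , loss-unique 0<t t≤b r+g≡a b*g<t*a t*a≤b*g+b , λ t<b → gain-unique 0<t t<b b*g<t*a t*a≤b*g+b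
    where
    open ≤-Reasoning
    regroup : ∀ t u r g → t * (r + g) + u * g ≡ t * r + (t + u) * g
    regroup = solve-∀
    t*a+u*g≡t*r+b*g : t * a + u * g ≡ t * r + b * g
    t*a+u*g≡t*r+b*g = begin-equality
      t * a + u * g          ≡⟨ cong (λ x → t * x + u * g) r+g≡a ⟨
      t * (r + g) + u * g    ≡⟨ regroup t u r g ⟩
      t * r + (t + u) * g    ≡⟨ cong (λ x → t * r + x * g) t+u≡b ⟩
      t * r + b * g          ∎
    b*g<t*a : b * g < t * a
    b*g<t*a = +-cancelʳ-< (u * g) _ _ (begin-strict
      b * g + u * g   <⟨ +-monoʳ-< (b * g) u*g<t*r ⟩
      b * g + t * r   ≡⟨ trans (+-comm (b * g) _) (sym t*a+u*g≡t*r+b*g) ⟩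
      t * a + u * g   ∎)
    swap-outer : ∀ x y z → x + y + z ≡ z + y + x
    swap-outer = solve-∀
    t*a≤b*g+b : t * a ≤ b * g + b
    t*a≤b*g+b = +-cancelʳ-≤ (u * g) _ _ (begin
      t * a + u * g       ≡⟨ t*a+u*g≡t*r+b*g ⟩
      t * r + b * g       ≤⟨ +-monoˡ-≤ (b * g) t*r≤u*g+b ⟩
      u * g + b + b * g   ≡⟨ swap-outer (u * g) b (b * g) ⟩
      b * g + b + u * g   ∎)
    0<t : 0 < t
    0<t = n≢0⇒n>0 (λ t≡0 → n≮0 (subst (λ x → b * g < x * a) t≡0 b*g<t*a))
    t≤b : t ≤ b
    t≤b = subst (t ≤_) t+u≡b (m≤m+n t u)

-- Shifting configurations modulo a

module _ {n : ℕ} where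

  below : (Fin n → ℕ) → ℕ → Subset n
  below Y m = subset (λ i → Y i <? m)

  atLeast : (Fin n → ℕ) → ℕ → Subset n
  atLeast Y ℓ = ∁ (below Y ℓ)

  module _ {Y : Fin n → ℕ} {i : Fin n} where

    ∈-below⁺ : ∀ {m} → Y i < m → i ∈ below Y m
    ∈-below⁺ {m} = ∈-subset⁺ (λ j → Y j <? m)

    ∈-below⁻ : ∀ {m} → i ∈ below Y m → Y i < m
    ∈-below⁻ {m} = ∈-subset⁻ (λ j → Y j <? m)

    ∈-atLeast⁺ : ∀ {ℓ} → ℓ ≤ Y i → i ∈ atLeast Y ℓ
    ∈-atLeast⁺ ℓ≤Yi = x∉p⇒x∈∁p (λ i∈below → ≤⇒≯ ℓ≤Yi (∈-below⁻ i∈below))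

    ∈-atLeast⁻ : ∀ {ℓ} → i ∈ atLeast Y ℓ → ℓ ≤ Y i
    ∈-atLeast⁻ i∈atLeast = ≮⇒≥ (λ Yi<ℓ → x∈∁p⇒x∉p i∈atLeast (∈-below⁺ Yi<ℓ))

  below-mono : ∀ Y {z m} → z ≤ m → below Y z ⊆ below Y m
  below-mono Y z≤m i∈ = ∈-below⁺ (<-≤-trans (∈-below⁻ i∈) z≤m)

  atLeast-anti : ∀ Y {ℓ ℓ′} → ℓ ≤ ℓ′ → atLeast Y ℓ′ ⊆ atLeast Y ℓ
  atLeast-anti Y ℓ≤ℓ′ i∈ = ∈-atLeast⁺ (≤-trans ℓ≤ℓ′ (∈-atLeast⁻ i∈))

  ∣below0∣≡0 : ∀ Y → ∣ below Y 0 ∣ ≡ 0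
  ∣below0∣≡0 Y = n≤0⇒n≡0 (≤-trans (p⊆q⇒∣p∣≤∣q∣ {q = Subset.⊥} (λ i∈ → contradiction (∈-below⁻ {Y = Y} i∈) n≮0)) (≤-reflexive (∣⊥∣≡0 n)))

below-cong : ∀ {n} {Y Y′ : Fin n → ℕ} → Y ≗ Y′ → ∀ m → below Y m ≡ below Y′ m
below-cong Y≗Y′ m = tabulate-cong (λ i → cong (λ y → does (y <? m)) (Y≗Y′ i))

module _ (a : ℕ) {n : ℕ} where

  Reduced : (Fin n → ℕ) → Set
  Reduced Y = ∀ i → Y i < a

  shift : ℕ → (Fin n → ℕ) → Fin n → ℕ
  shift m Y i with Y i <? m
  ... | yes _ = Y i + a ∸ m
  ... | no  _ = Y i ∸ m

  MinimalShift : ℕ → (Fin n → ℕ) → ℕ → Set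
  MinimalShift u Y m = ∀ {z} → z ≤ u → sum (shift m Y) ≤ sum (shift z Y)

  module _ {m : ℕ} (Y : Fin n → ℕ) (i : Fin n) where

    shift-wraps : m ≤ a → Y i < m → shift m Y i + m ≡ Y i + a
    shift-wraps m≤a Yi<m with Y i <? m
    ... | yes _     = m∸n+n≡m (≤-trans m≤a (m≤n+m a (Y i)))
    ... | no Yi≮m   = contradiction Yi<m Yi≮m

    shift-drops : m ≤ Y i → shift m Y i + m ≡ Y i
    shift-drops m≤Yi with Y i <? m
    ... | yes Yi<m  = contradiction Yi<m (≤⇒≯ m≤Yi)
    ... | no _      = m∸n+n≡m m≤Yi

  shift-reduced : ∀ {m Y} → m ≤ a → Reduced Y → Reduced (shift m Y)
  shift-reduced {m} {Y} m≤a reduced i with <-≤-connex (Y i) m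
  ... | inj₁ Yi<m = +-cancelʳ-< m _ _ (begin-strict
    shift m Y i + m  ≡⟨ shift-wraps Y i m≤a Yi<m ⟩
    Y i + a          <⟨ +-monoˡ-< a Yi<m ⟩
    m + a            ≡⟨ +-comm m a ⟩
    a + m            ∎)
    where open ≤-Reasoning
  ... | inj₂ m≤Yi = ≤-<-trans (≤-trans (m≤m+n _ m) (≤-reflexive (shift-drops Y i m≤Yi))) (reduced i)

  sum-shift : ∀ {m} Y → m ≤ a → sum (shift m Y) + n * m ≡ sum Y + ∣ below Y m ∣ * a
  sum-shift {m} Y m≤a = begin
    sum (shift m Y) + n * m                      ≡⟨ cong (sum (shift m Y) +_) (sum-const n m) ⟨
    sum (shift m Y) + sum {n} (λ _ → m)          ≡⟨ ∑-distrib-+ (shift m Y) (λ _ → m) ⟨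
    sum (λ i → shift m Y i + m)                  ≡⟨ +-identityʳ _ ⟨
    sum (λ i → shift m Y i + m) + 0              ≡⟨ cong (sum (λ i → shift m Y i + m) +_) (*-zeroʳ ∣ ∁ (below Y m) ∣) ⟨
    sum (λ i → shift m Y i + m) + ∣ ∁ (below Y m) ∣ * 0
                                                 ≡⟨ sum-split (below Y m) wrapped dropped ⟩
    sum Y + ∣ below Y m ∣ * a                    ∎
    where
    open ≡-Reasoning
    wrapped : ∀ {i} → i ∈ below Y m → shift m Y i + m ≡ Y i + a
    wrapped {i} i∈ = shift-wraps Y i m≤a (∈-below⁻ i∈)
    dropped : ∀ {i} → i ∉ below Y m → shift m Y i + m + 0 ≡ Y i
    dropped {i} i∉ = trans (+-identityʳ _) (shift-drops {m} Y i (≮⇒≥ (i∉ ∘ ∈-below⁺)))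

  sum-shift-suc : ∀ {z} Y → suc z ≤ a → sum (shift z Y) ≤ sum (shift (suc z) Y) + n
  sum-shift-suc {z} Y 1+z≤a = +-cancelʳ-≤ (n * z) _ _ (begin
    sum (shift z Y) + n * z             ≡⟨ sum-shift Y (<⇒≤ 1+z≤a) ⟩
    sum Y + ∣ below Y z ∣ * a           ≤⟨ +-monoʳ-≤ (sum Y) (*-monoˡ-≤ a (p⊆q⇒∣p∣≤∣q∣ (below-mono Y (n≤1+n z)))) ⟩
    sum Y + ∣ below Y (suc z) ∣ * a     ≡⟨ sum-shift Y 1+z≤a ⟨
    sum (shift (suc z) Y) + n * suc z   ≡⟨ trans (cong (sum (shift (suc z) Y) +_) (*-suc n z)) (sym (+-assoc _ n (n * z))) ⟩
    sum (shift (suc z) Y) + n + n * z   ∎)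
    where open ≤-Reasoning

  sum-shift≤⇒∣below∣≤ : ∀ {m z} Y → m ≤ a → z ≤ a → sum (shift m Y) ≤ sum (shift z Y) →
                 ∣ below Y m ∣ * a + n * z ≤ ∣ below Y z ∣ * a + n * m
  sum-shift≤⇒∣below∣≤ {m} {z} Y m≤a z≤a Σm≤Σz = +-cancelˡ-≤ (sum Y) _ _ (begin
    sum Y + (∣ below Y m ∣ * a + n * z)   ≡⟨ +-assoc (sum Y) _ _ ⟨
    sum Y + ∣ below Y m ∣ * a + n * z     ≡⟨ cong (_+ n * z) (sum-shift Y m≤a) ⟨
    sum (shift m Y) + n * m + n * z       ≤⟨ +-monoˡ-≤ (n * z) (+-monoˡ-≤ (n * m) Σm≤Σz) ⟩
    sum (shift z Y) + n * m + n * z       ≡⟨ +-rightComm (sum (shift z Y)) (n * m) (n * z) ⟩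
    sum (shift z Y) + n * z + n * m       ≡⟨ cong (_+ n * m) (sum-shift Y z≤a) ⟩
    sum Y + ∣ below Y z ∣ * a + n * m     ≡⟨ +-assoc (sum Y) _ _ ⟩
    sum Y + (∣ below Y z ∣ * a + n * m)   ∎)
    where open ≤-Reasoning

  prefix-minimal-shift-above : ∀ {m₀} Y → m₀ ≤ a → sum (shift m₀ Y) < sum Y →
    ∃[ m ] m < m₀ × MinimalShift m Y m × sum (shift m₀ Y) < sum (shift m Y) × sum (shift m Y) ≤ sum (shift m₀ Y) + n
  prefix-minimal-shift-above {m₀} Y m₀≤a w[m₀]<w[0] = first-close (least (λ z → w z ≤? w m₀ + n) (m≤m+n (w m₀) n))
    where
    w : ℕ → ℕ
    w z = sum (shift z Y)
    w[m₀]<w : ∀ m → m ≤ a → (∀ {z} → z < m → ¬ w z ≤ w m₀ + n) → w m₀ < w m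
    w[m₀]<w zero    _     _         = w[m₀]<w[0]
    w[m₀]<w (suc z) 1+z≤a too-heavy = +-cancelʳ-< n _ _ (<-≤-trans (≰⇒> (too-heavy ≤-refl)) (sum-shift-suc Y 1+z≤a))
    first-close : (∃[ m ] m ≤ m₀ × w m ≤ w m₀ + n × (∀ {z} → z < m → ¬ w z ≤ w m₀ + n)) →
                  ∃[ m ] m < m₀ × MinimalShift m Y m × w m₀ < w m × w m ≤ w m₀ + n
    first-close (m , m≤m₀ , close , too-heavy) = m , m<m₀ , minimal , w[m₀]<w[m] , close
      where
      w[m₀]<w[m] : w m₀ < w m
      w[m₀]<w[m] = w[m₀]<w m (≤-trans m≤m₀ m₀≤a) too-heavy
      m<m₀ : m < m₀
      m<m₀ = ≤∧≢⇒< m≤m₀ (λ m≡m₀ → <-irrefl (cong w (sym m≡m₀)) w[m₀]<w[m])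
      minimal : MinimalShift m Y m
      minimal {z} z≤m with m≤n⇒m<n∨m≡n z≤m
      ... | inj₁ z<m  = ≤-trans close (<⇒≤ (≰⇒> (too-heavy z<m)))
      ... | inj₂ refl = ≤-refl

  shift-compare : ∀ {m m₀} Y i → m ≤ m₀ → m₀ ≤ a →
                   shift m Y i ≡ shift m₀ Y i + (m₀ ∸ m) ⊎ shift m Y i + (a ∸ (m₀ ∸ m)) ≡ shift m₀ Y i
  shift-compare {m} {m₀} Y i m≤m₀ m₀≤a = byPosition (<-≤-connex (Y i) m) (<-≤-connex (Y i) m₀)
    where
    open ≡-Reasoning
    X = shift m Y i
    W = shift m₀ Y i
    r = m₀ ∸ m
    g = a ∸ r
    r+m≡m₀ : r + m ≡ m₀
    r+m≡m₀ = m∸n+n≡m m≤m₀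
    r+g≡a : r + g ≡ a
    r+g≡a = m+[n∸m]≡n (≤-trans (m∸n≤m m₀ m) m₀≤a)
    W+r+m≡W+m₀ : W + r + m ≡ W + m₀
    W+r+m≡W+m₀ = trans (+-assoc W r m) (cong (W +_) r+m≡m₀)
    regroup : ∀ x g r m → x + g + (r + m) ≡ x + m + (r + g)
    regroup = solve-∀
    byPosition : Y i < m ⊎ m ≤ Y i → Y i < m₀ ⊎ m₀ ≤ Y i → X ≡ W + r ⊎ X + g ≡ W
    byPosition (inj₁ Yi<m) (inj₁ Yi<m₀) = inj₁ (+-cancelʳ-≡ m _ _ (begin
      X + m         ≡⟨ shift-wraps Y i (≤-trans m≤m₀ m₀≤a) Yi<m ⟩
      Y i + a       ≡⟨ shift-wraps Y i m₀≤a Yi<m₀ ⟨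
      W + m₀        ≡⟨ W+r+m≡W+m₀ ⟨
      W + r + m     ∎))
    byPosition (inj₁ Yi<m) (inj₂ m₀≤Yi) = contradiction (≤-trans m≤m₀ m₀≤Yi) (<⇒≱ Yi<m)
    byPosition (inj₂ m≤Yi) (inj₁ Yi<m₀) = inj₂ (+-cancelʳ-≡ m₀ _ _ (begin
      X + g + m₀          ≡⟨ cong (X + g +_) r+m≡m₀ ⟨
      X + g + (r + m)     ≡⟨ regroup X g r m ⟩
      X + m + (r + g)     ≡⟨ cong₂ _+_ (shift-drops Y i m≤Yi) r+g≡a ⟩
      Y i + a             ≡⟨ shift-wraps Y i m₀≤a Yi<m₀ ⟨
      W + m₀              ∎))
    byPosition (inj₂ m≤Yi) (inj₂ m₀≤Yi) = inj₁ (+-cancelʳ-≡ m _ _ (begin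
      X + m         ≡⟨ shift-drops Y i m≤Yi ⟩
      Y i           ≡⟨ shift-drops Y i m₀≤Yi ⟨
      W + m₀        ≡⟨ W+r+m≡W+m₀ ⟨
      W + r + m     ∎))

  ∣atLeast-shift∣≤ : ∀ {m} Y ℓ → m ≤ a → ∣ atLeast (shift m Y) ℓ ∣ ≤ ∣ atLeast Y (ℓ + m) ∣ + ∣ below Y m ∣
  ∣atLeast-shift∣≤ {m} Y ℓ m≤a = ≤-trans (p⊆q⇒∣p∣≤∣q∣ ⊆∪) (∣p∪q∣≤∣p∣+∣q∣ (atLeast Y (ℓ + m)) (below Y m))
    where
    ⊆∪ : atLeast (shift m Y) ℓ ⊆ atLeast Y (ℓ + m) ∪ below Y m
    ⊆∪ {i} i∈ with <-≤-connex (Y i) m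
    ... | inj₁ Yi<m = x∈p∪q⁺ (inj₂ (∈-below⁺ Yi<m))
    ... | inj₂ m≤Yi = x∈p∪q⁺ (inj₁ (∈-atLeast⁺ (subst (ℓ + m ≤_) (shift-drops Y i m≤Yi) (+-monoˡ-≤ m (∈-atLeast⁻ i∈)))))

  ∣atLeast-shift∣+∣below∣≤ : ∀ {m ℓ} Y → Reduced Y → m ≤ a → ℓ ≤ a → a ≤ ℓ + m →
                             ∣ atLeast (shift m Y) ℓ ∣ + ∣ below Y (ℓ + m ∸ a) ∣ ≤ ∣ below Y m ∣
  ∣atLeast-shift∣+∣below∣≤ {m} {ℓ} Y reduced m≤a ℓ≤a a≤ℓ+m = begin
    ∣ atLeast (shift m Y) ℓ ∣ + ∣ below Y z ∣  ≤⟨ +-monoˡ-≤ ∣ below Y z ∣ (p⊆q⇒∣p∣≤∣q∣ ⊆─) ⟩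
    ∣ below Y m ─ below Y z ∣ + ∣ below Y z ∣  ≡⟨ ∣p─q∣+∣q∣≡∣p∣ (below-mono Y z≤m) ⟩
    ∣ below Y m ∣                              ∎
    where
    open ≤-Reasoning
    z = ℓ + m ∸ a
    z+a≡ℓ+m : z + a ≡ ℓ + m
    z+a≡ℓ+m = m∸n+n≡m a≤ℓ+m
    z≤m : z ≤ m
    z≤m = +-cancelʳ-≤ a z m (≤-trans (≤-reflexive z+a≡ℓ+m) (≤-trans (+-monoˡ-≤ m ℓ≤a) (≤-reflexive (+-comm a m))))
    ⊆─ : atLeast (shift m Y) ℓ ⊆ below Y m ─ below Y z
    ⊆─ {i} i∈ with <-≤-connex (Y i) m
    ... | inj₁ Yi<m = x∈p∧x∉q⇒x∈p─q (∈-below⁺ Yi<m) (λ i∈below → <⇒≱ (∈-below⁻ i∈below) z≤Yi)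
      where
      z≤Yi : z ≤ Y i
      z≤Yi = +-cancelʳ-≤ a z (Y i) (begin
        z + a             ≡⟨ z+a≡ℓ+m ⟩
        ℓ + m             ≤⟨ +-monoˡ-≤ m (∈-atLeast⁻ i∈) ⟩
        shift m Y i + m   ≡⟨ shift-wraps Y i m≤a Yi<m ⟩
        Y i + a           ∎)
    ... | inj₂ m≤Yi = contradiction (begin
        a                 ≤⟨ a≤ℓ+m ⟩
        ℓ + m             ≤⟨ +-monoˡ-≤ m (∈-atLeast⁻ i∈) ⟩
        shift m Y i + m   ≡⟨ shift-drops Y i m≤Yi ⟩
        Y i               ∎) (<⇒≱ (reduced i))

-- Stability and reverse firings

increased : ∀ {n} → (Fin n → ℕ) → (Fin n → ℕ) → Subset n
increased W V = subset (λ i → W i <? V i)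

module _ {n r g : ℕ} {W V : Fin n → ℕ} (0<r : 0 < r) (step : ∀ i → V i ≡ W i + r ⊎ V i + g ≡ W i) where

  ∈-increased⇒raised : ∀ {i} → i ∈ increased W V → V i ≡ W i + r
  ∈-increased⇒raised {i} i∈ with step i
  ... | inj₁ V≡W+r = V≡W+r
  ... | inj₂ V+g≡W = contradiction (∈-subset⁻ (λ j → W j <? V j) i∈) (≤⇒≯ (≤-trans (m≤m+n (V i) g) (≤-reflexive V+g≡W)))

  ∉-increased⇒lowered : ∀ {i} → i ∉ increased W V → V i + g ≡ W i
  ∉-increased⇒lowered {i} i∉ with step i
  ... | inj₂ V+g≡W = V+g≡W
  ... | inj₁ V≡W+r = contradiction (∈-subset⁺ (λ j → W j <? V j) (subst (W i <_) (sym V≡W+r) (m<m+n (W i) 0<r))) i∉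

module _ (a b : ℕ) .{{_ : NonZero b}} where

  ReverseFiring : Subset b → (Fin b → ℕ) → (Fin b → ℕ) → Set
  ReverseFiring T Y Z = (∀ {i} → i ∈ T → Z i ≡ Y i + loss a b ∣ T ∣) × (∀ {i} → i ∉ T → Z i + gain a b ∣ T ∣ ≡ Y i)

module _ (a b k : ℕ) .{{_ : NonZero b}} where

  -- φ S is legal on Y exactly when every vertex of S holds at least loss ∣ S ∣ chips.
  Stable : (Fin b → ℕ) → Set
  Stable Y = ∀ s → 0 < s → s ≤ suc k → ∣ atLeast Y (loss a b s) ∣ < s

  stable? : ∀ Y → Dec (Stable Y)
  stable? Y = map′ (λ h s 0<s s≤1+k → h (s≤s s≤1+k) 0<s) (λ h {s} s<2+k 0<s → h s 0<s (s≤s⁻¹ s<2+k))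
                   (allUpTo? (λ s → 0 <? s →-dec ∣ atLeast Y (loss a b s) ∣ <? s) (suc (suc k)))

module _ {a b k : ℕ} .{{_ : NonZero b}} (0<a : 0 < a) (k<b : k < b) where

  private
    ≤b : ∀ {s} → s ≤ suc k → s ≤ b
    ≤b s≤1+k = ≤-trans s≤1+k k<b

  stable⇒reduced : ∀ {Y} → Stable a b k Y → Reduced a Y
  stable⇒reduced {Y} stable i = ≰⇒> λ a≤Yi →
    <⇒≱ (stable 1 z<s (s≤s z≤n)) (x∈p⇒0<∣p∣ (∈-atLeast⁺ {Y = Y} (≤-trans (loss≤a a b 0<a z<s (≤b (s≤s z≤n))) a≤Yi)))

  -- If loss s + m > a, only vertices that wrapped around can still afford to lose loss s.
  ∣atLeast-shift∣<-wrapped : ∀ {m s} (Y : Fin b → ℕ) → Reduced a Y → m ≤ a → MinimalShift a m Y m → 0 < s → s ≤ b →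
                             a < loss a b s + m → ∣ atLeast (shift a m Y) (loss a b s) ∣ < s
  ∣atLeast-shift∣<-wrapped {m} {s} Y reduced m≤a minimal 0<s s≤b a<L+m =
    ≰⇒> λ s≤N → <⇒≱ (b*a<b*loss+s*a a b s≤b) (+-cancelʳ-≤ (b * m) _ _ (begin
      b * L + s * a + b * m       ≡⟨ regroup (b * L) (s * a) (b * m) ⟩
      s * a + (b * L + b * m)     ≡⟨ cong (s * a +_) b*L+b*m≡b*z+b*a ⟩
      s * a + (b * z + b * a)     ≡⟨ +-assoc (s * a) (b * z) (b * a) ⟨
      s * a + b * z + b * a       ≤⟨ +-monoˡ-≤ (b * a) (s*a+b*z≤b*m s≤N) ⟩
      b * m + b * a               ≡⟨ +-comm (b * m) (b * a) ⟩
      b * a + b * m               ∎))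
    where
    open ≤-Reasoning
    L = loss a b s
    N = ∣ atLeast (shift a m Y) L ∣
    c : ℕ → ℕ
    c x = ∣ below Y x ∣
    z = L + m ∸ a
    z+a≡L+m : z + a ≡ L + m
    z+a≡L+m = m∸n+n≡m (<⇒≤ a<L+m)
    z≤m : z ≤ m
    z≤m = +-cancelʳ-≤ a z m (≤-trans (≤-reflexive z+a≡L+m) (≤-trans (+-monoˡ-≤ m (loss≤a a b 0<a 0<s s≤b)) (≤-reflexive (+-comm a m))))
    regroup : ∀ x y w → x + y + w ≡ y + (x + w)
    regroup = solve-∀
    b*L+b*m≡b*z+b*a : b * L + b * m ≡ b * z + b * a
    b*L+b*m≡b*z+b*a = begin-equality
      b * L + b * m   ≡⟨ *-distribˡ-+ b L m ⟨
      b * (L + m)     ≡⟨ cong (b *_) z+a≡L+m ⟨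
      b * (z + a)     ≡⟨ *-distribˡ-+ b z a ⟩
      b * z + b * a   ∎
    collect : ∀ x y w v → x * w + (y * w + v) ≡ (y + x) * w + v
    collect = solve-∀
    s*a+b*z≤b*m : s ≤ N → s * a + b * z ≤ b * m
    s*a+b*z≤b*m s≤N = +-cancelˡ-≤ (c z * a) _ _ (begin
      c z * a + (s * a + b * z)   ≡⟨ collect (c z) s a (b * z) ⟩
      (s + c z) * a + b * z       ≤⟨ +-monoˡ-≤ (b * z) (*-monoˡ-≤ a (≤-trans (+-monoˡ-≤ (c z) s≤N)
                                       (∣atLeast-shift∣+∣below∣≤ a Y reduced m≤a (loss≤a a b 0<a 0<s s≤b) (<⇒≤ a<L+m)))) ⟩
      c m * a + b * z             ≤⟨ sum-shift≤⇒∣below∣≤ a Y m≤a (≤-trans z≤m m≤a) (minimal z≤m) ⟩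
      c z * a + b * m             ∎)

  minimal-shift-stable : ∀ {m} (Y : Fin b → ℕ) → Reduced a Y → m ≤ a → MinimalShift a a Y m → Stable a b k (shift a m Y)
  minimal-shift-stable {m} Y reduced m≤a minimal s 0<s s≤1+k with loss a b s + m ≤? a
  ... | no L+m≰a = ∣atLeast-shift∣<-wrapped Y reduced m≤a (λ z≤m → minimal (≤-trans z≤m m≤a)) 0<s (≤b s≤1+k) (≰⇒> L+m≰a)
  ... | yes L+m≤a = ≤-<-trans (∣atLeast-shift∣≤ a Y L m≤a) (≰⇒> few)
    where
    open ≤-Reasoning
    L = loss a b s
    c : ℕ → ℕ
    c x = ∣ below Y x ∣
    n₂ = ∣ atLeast Y (L + m) ∣
    move : ∀ b L s a m → b * L + s * a + b * m ≡ s * a + b * (L + m)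
    move = solve-∀
    split : ∀ x y a w → (x + y) * a + w ≡ x * a + (y * a + w)
    split = solve-∀
    merge : ∀ x y a w → x * a + (y * a + w) ≡ (y + x) * a + w
    merge = solve-∀
    few : ¬ (s ≤ n₂ + c m)
    few s≤ = <⇒≱ (b*a<b*loss+s*a a b (≤b s≤1+k)) (+-cancelʳ-≤ (b * m) _ _ (begin
      b * L + s * a + b * m               ≡⟨ move b L s a m ⟩
      s * a + b * (L + m)                 ≤⟨ +-monoˡ-≤ (b * (L + m)) (*-monoˡ-≤ a s≤) ⟩
      (n₂ + c m) * a + b * (L + m)        ≡⟨ split n₂ (c m) a (b * (L + m)) ⟩
      n₂ * a + (c m * a + b * (L + m))    ≤⟨ +-monoʳ-≤ (n₂ * a) (sum-shift≤⇒∣below∣≤ a Y m≤a L+m≤a (minimal L+m≤a)) ⟩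
      n₂ * a + (c (L + m) * a + b * m)    ≡⟨ merge n₂ (c (L + m)) a (b * m) ⟩
      (c (L + m) + n₂) * a + b * m        ≡⟨ cong (λ x → x * a + b * m) (∣p∣+∣∁p∣≡n (below Y (L + m))) ⟩
      b * a + b * m                       ∎))

  prefix-minimal-shift-stable : ∀ {m} {Y : Fin b → ℕ} → Stable a b k Y → m ≤ a → MinimalShift a m Y m →
                            Stable a b k (shift a m Y)
  prefix-minimal-shift-stable {m} {Y} stable m≤a minimal s 0<s s≤1+k with loss a b s + m ≤? a
  ... | no L+m≰a = ∣atLeast-shift∣<-wrapped Y (stable⇒reduced stable) m≤a minimal 0<s (≤b s≤1+k) (≰⇒> L+m≰a)
  ... | yes L+m≤a = ≤-<-trans (∣atLeast-shift∣≤ a Y L m≤a) (≰⇒> few)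
    where
    open ≤-Reasoning
    L = loss a b s
    c : ℕ → ℕ
    c x = ∣ below Y x ∣
    n₂ = ∣ atLeast Y (L + m) ∣
    c[m]*a≤b*m : c m * a ≤ b * m
    c[m]*a≤b*m = begin
      c m * a               ≡⟨ trans (cong (c m * a +_) (*-zeroʳ b)) (+-identityʳ _) ⟨
      c m * a + b * 0       ≤⟨ sum-shift≤⇒∣below∣≤ a Y m≤a z≤n (minimal z≤n) ⟩
      c 0 * a + b * m       ≡⟨ cong (λ x → x * a + b * m) (∣below0∣≡0 Y) ⟩
      b * m                 ∎
    b*[L+m]+n′*a≤b*a : ∀ n′ → n′ ≤ n₂ → n′ ≤ suc k → b * (L + m) + n′ * a ≤ b * a
    b*[L+m]+n′*a≤b*a zero       _     _     = ≤-trans (≤-reflexive (+-identityʳ _)) (*-monoʳ-≤ b L+m≤a)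
    b*[L+m]+n′*a≤b*a n′@(suc _) n′≤n₂ n′≤1+k = b*ℓ+s*a≤b*a a b (≤b n′≤1+k) (≰⇒> λ Ln′≤L+m →
      <⇒≱ (stable n′ z<s n′≤1+k) (≤-trans n′≤n₂ (p⊆q⇒∣p∣≤∣q∣ (atLeast-anti Y Ln′≤L+m))))
    few : ¬ (s ≤ n₂ + c m)
    few s≤ = <⇒≱ (b*a<b*loss+s*a a b (≤b s≤1+k)) (begin
      b * L + s * a                       ≤⟨ +-monoʳ-≤ (b * L) (*-monoˡ-≤ a (m≤n+m∸n s (c m))) ⟩
      b * L + (c m + n′) * a              ≡⟨ cong (b * L +_) (*-distribʳ-+ a (c m) n′) ⟩
      b * L + (c m * a + n′ * a)          ≤⟨ +-monoʳ-≤ (b * L) (+-monoˡ-≤ (n′ * a) c[m]*a≤b*m) ⟩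
      b * L + (b * m + n′ * a)            ≡⟨ +-assoc (b * L) (b * m) (n′ * a) ⟨
      b * L + b * m + n′ * a              ≡⟨ cong (_+ n′ * a) (*-distribˡ-+ b L m) ⟨
      b * (L + m) + n′ * a                ≤⟨ b*[L+m]+n′*a≤b*a n′ n′≤n₂ (≤-trans (m∸n≤m s (c m)) s≤1+k) ⟩
      b * a                               ∎)
      where
      n′ = s ∸ c m
      n′≤n₂ : n′ ≤ n₂
      n′≤n₂ = m≤n+o⇒m∸n≤o s (c m) (≤-trans s≤ (≤-reflexive (+-comm n₂ (c m))))

stable-resp-≗ : ∀ {a b k} .{{_ : NonZero b}} {Y Y′ : Fin b → ℕ} → Y ≗ Y′ → Stable a b k Y → Stable a b k Y′
stable-resp-≗ {a} {b} Y≗Y′ stable s 0<s s≤1+k = subst (λ p → ∣ ∁ p ∣ < s) (below-cong Y≗Y′ (loss a b s)) (stable s 0<s s≤1+k)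

module _ {a b : ℕ} .{{_ : NonZero b}} (coprime : Coprime a b) where

  sum-shift≢sum : ∀ {m} (Y : Fin b → ℕ) → 0 < m → m < a → sum (shift a m Y) ≢ sum Y
  sum-shift≢sum {m} Y 0<m m<a eq = a*m≢b*n coprime 0<m m<a (trans (*-comm a ∣ below Y m ∣)
    (sym (+-cancelˡ-≡ (sum Y) _ _ (trans (cong (_+ b * m) (sym eq)) (sum-shift a Y (<⇒≤ m<a))))))

  reverse-firing-heavier : ∀ {T} {Y Z : Fin b → ℕ} → 0 < ∣ T ∣ → ReverseFiring a b T Y Z → sum Y < sum Z
  reverse-firing-heavier {T} {Y} {Z} 0<t (raised , lowered) = +-cancelʳ-< ((b ∸ t) * G) _ _ (begin-strict
    sum Y + (b ∸ t) * G   <⟨ +-monoʳ-< (sum Y) ([b∸t]*gain<t*loss coprime 0<t (∣p∣≤n T)) ⟩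
    sum Y + t * L         ≡⟨ sum-split T raised lowered ⟨
    sum Z + ∣ ∁ T ∣ * G   ≡⟨ cong (λ u → sum Z + u * G) (∣∁p∣≡n∸∣p∣ T) ⟩
    sum Z + (b ∸ t) * G   ∎)
    where
    open ≤-Reasoning
    t = ∣ T ∣
    L = loss a b t
    G = gain a b t

  reverse-firing-between : ∀ {r} (W V : Fin b → ℕ) → 0 < r → r ≤ a →
                           (∀ i → V i ≡ W i + r ⊎ V i + (a ∸ r) ≡ W i) → sum W < sum V → sum V ≤ sum W + b →
                           ∃[ T ] 0 < ∣ T ∣ × ReverseFiring a b T W V
  reverse-firing-between {r} W V 0<r r≤a step ΣW<ΣV ΣV≤ΣW+b = T , 0<t , raised′ , lowered′
    where
    open ≤-Reasoning
    g = a ∸ r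
    T = increased W V
    t = ∣ T ∣
    u = ∣ ∁ T ∣
    balance : sum V + u * g ≡ sum W + t * r
    balance = sum-split T (∈-increased⇒raised 0<r step) (∉-increased⇒lowered 0<r step)
    u*g<t*r : u * g < t * r
    u*g<t*r = +-cancelˡ-< (sum W) _ _ (begin-strict
      sum W + u * g   <⟨ +-monoˡ-< (u * g) ΣW<ΣV ⟩
      sum V + u * g   ≡⟨ balance ⟩
      sum W + t * r   ∎)
    t*r≤u*g+b : t * r ≤ u * g + b
    t*r≤u*g+b = +-cancelˡ-≤ (sum W) _ _ (begin
      sum W + t * r       ≡⟨ balance ⟨
      sum V + u * g       ≤⟨ +-monoˡ-≤ (u * g) ΣV≤ΣW+b ⟩
      sum W + b + u * g   ≡⟨ trans (+-assoc (sum W) b (u * g)) (cong (sum W +_) (+-comm b (u * g))) ⟩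
      sum W + (u * g + b) ∎)
    amounts = reverse-firing-amounts coprime (∣p∣+∣∁p∣≡n T) (m+[n∸m]≡n r≤a) u*g<t*r t*r≤u*g+b
    0<t = proj₁ amounts
    raised′ : ∀ {i} → i ∈ T → V i ≡ W i + loss a b t
    raised′ {i} i∈T = trans (∈-increased⇒raised 0<r step i∈T) (cong (W i +_) (sym (proj₁ (proj₂ amounts))))
    lowered′ : ∀ {i} → i ∉ T → V i + gain a b t ≡ W i
    lowered′ {i} i∉T = trans (cong (V i +_) (proj₂ (proj₂ amounts) (x∉p⇒∣p∣<n i∉T))) (∉-increased⇒lowered 0<r step i∉T)

-- Integer configurations and the cosets of K

-- Imported only now: its prefix +_ makes sections such as (x +_) ambiguous.
open import Data.Integer using (+_)
open import Data.Integer.DivMod using (a≡a%ℕn+[a/ℕn]*n; n%ℕd<d)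

toConfig : ∀ {n} → (Fin n → ℕ) → Config n
toConfig Y i = + Y i

module _ (a b : ℕ) .{{_ : NonZero b}} {S : Subset b} (D : Config b) {i : Fin b} where

  φ-∈ : i ∈ S → φ a b S D i ≡ D i ℤ.- + loss a b ∣ S ∣
  φ-∈ i∈S rewrite []=⇒lookup i∈S = refl

  φ-∉ : i ∉ S → φ a b S D i ≡ D i ℤ.+ + gain a b ∣ S ∣
  φ-∉ i∉S with lookup S i in eq
  ... | true  = contradiction (lookup⇒[]= i S eq) i∉S
  ... | false = refl

  β-∈ : i ∈ S → β a b S D i ≡ D i ℤ.+ + loss a b ∣ S ∣
  β-∈ i∈S rewrite []=⇒lookup i∈S = refl

  β-∉ : i ∉ S → β a b S D i ≡ D i ℤ.- + gain a b ∣ S ∣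
  β-∉ i∉S with lookup S i in eq
  ... | true  = contradiction (lookup⇒[]= i S eq) i∉S
  ... | false = refl

module _ (a b : ℕ) .{{_ : NonZero b}} (S : Subset b) {D E : Config b} (D≗E : D ≗ E) where

  φ-cong : φ a b S D ≗ φ a b S E
  φ-cong i = cong (λ x → φ a b S (λ _ → x) i) (D≗E i)

  β-cong : β a b S D ≗ β a b S E
  β-cong i = cong (λ x → β a b S (λ _ → x) i) (D≗E i)

kStable-resp-≗ : ∀ {a b k} .{{_ : NonZero b}} {D E : Config b} → D ≗ E → kStable a b k D → kStable a b k E
kStable-resp-≗ {a} {b} D≗E (nonNeg , noLegalFiring) =
  (λ i → subst (0ℤ ℤ.≤_) (D≗E i) (nonNeg i)) ,
  (λ S 0<∣S∣ ∣S∣≤1+k legal → noLegalFiring S 0<∣S∣ ∣S∣≤1+k (λ i → subst (0ℤ ℤ.≤_) (sym (φ-cong a b S D≗E i)) (legal i)))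

nonNeg⇒≗toConfig : ∀ {n} {D : Config n} → NonNeg D → D ≗ toConfig (λ i → ℤ.∣ D i ∣)
nonNeg⇒≗toConfig nonNeg i = sym (ℤ.0≤i⇒+∣i∣≡i (nonNeg i))

module _ {a b : ℕ} .{{_ : NonZero b}} {T : Subset b} {Y Z : Fin b → ℕ} where

  β≗⇒ReverseFiring : β a b T (toConfig Y) ≗ toConfig Z → ReverseFiring a b T Y Z
  β≗⇒ReverseFiring β≗Z = raised , lowered
    where
    cancel : ∀ y g → (y ℤ.- g) ℤ.+ g ≡ y
    cancel = ℤ-solve-∀
    raised : ∀ {i} → i ∈ T → Z i ≡ Y i + loss a b ∣ T ∣
    raised {i} i∈T = ℤ.+-injective (trans (sym (β≗Z i)) (β-∈ a b (toConfig Y) i∈T))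
    lowered : ∀ {i} → i ∉ T → Z i + gain a b ∣ T ∣ ≡ Y i
    lowered {i} i∉T = ℤ.+-injective (trans (cong (λ z → z ℤ.+ + gain a b ∣ T ∣) (trans (sym (β≗Z i)) (β-∉ a b (toConfig Y) i∉T)))
                                            (cancel (+ Y i) (+ gain a b ∣ T ∣)))

  ReverseFiring⇒β≗ : ReverseFiring a b T Y Z → β a b T (toConfig Y) ≗ toConfig Z
  ReverseFiring⇒β≗ (raised , lowered) i with i ∈? T
  ... | yes i∈T = trans (β-∈ a b (toConfig Y) i∈T) (cong +_ (sym (raised i∈T)))
  ... | no i∉T = begin
    β a b T (toConfig Y) i      ≡⟨ β-∉ a b (toConfig Y) i∉T ⟩
    + Y i ℤ.- + G               ≡⟨ cong (λ y → + y ℤ.- + G) (lowered i∉T) ⟨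
    (+ Z i ℤ.+ + G) ℤ.- + G     ≡⟨ cancel (+ Z i) (+ G) ⟩
    + Z i                       ∎
    where
    open ≡-Reasoning
    G = gain a b ∣ T ∣
    cancel : ∀ z g → (z ℤ.+ g) ℤ.- g ≡ z
    cancel = ℤ-solve-∀

module _ {a b k : ℕ} .{{_ : NonZero b}} where

  stable⇒kStable : ∀ {Y} → Stable a b k Y → kStable a b k (toConfig Y)
  stable⇒kStable {Y} stable = (λ i → +≤+ z≤n) , noLegalFiring
    where
    noLegalFiring : ∀ S → 0 < ∣ S ∣ → ∣ S ∣ ≤ suc k → ¬ NonNeg (φ a b S (toConfig Y))
    noLegalFiring S 0<∣S∣ ∣S∣≤1+k legal = <⇒≱ (stable ∣ S ∣ 0<∣S∣ ∣S∣≤1+k) (p⊆q⇒∣p∣≤∣q∣ S⊆atLeast)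
      where
      S⊆atLeast : S ⊆ atLeast Y (loss a b ∣ S ∣)
      S⊆atLeast {i} i∈S = ∈-atLeast⁺ {Y = Y} {ℓ = loss a b ∣ S ∣} (ℤ.drop‿+≤+ (ℤ.0≤i-j⇒j≤i (subst (0ℤ ℤ.≤_) (φ-∈ a b (toConfig Y) i∈S) (legal i))))

  kStable⇒stable : ∀ {Y} → kStable a b k (toConfig Y) → Stable a b k Y
  kStable⇒stable {Y} (_ , noLegalFiring) s 0<s s≤1+k =
    ≰⇒> λ s≤∣atLeast∣ → firing-legal (∃⊆-of-size (atLeast Y (loss a b s)) s≤∣atLeast∣)
    where
    firing-legal : (∃[ S ] S ⊆ atLeast Y (loss a b s) × ∣ S ∣ ≡ s) → ⊥
    firing-legal (S , S⊆atLeast , ∣S∣≡s) =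
      noLegalFiring S (subst (0 <_) (sym ∣S∣≡s) 0<s) (subst (_≤ suc k) (sym ∣S∣≡s) s≤1+k) legal
      where
      legal : NonNeg (φ a b S (toConfig Y))
      legal i with i ∈? S
      ... | yes i∈S = subst (0ℤ ℤ.≤_) (sym (φ-∈ a b (toConfig Y) i∈S))
                        (ℤ.i≤j⇒0≤j-i (+≤+ (subst (λ x → loss a b x ≤ Y i) (sym ∣S∣≡s) (∈-atLeast⁻ {Y = Y} (S⊆atLeast i∈S)))))
      ... | no i∉S  = subst (0ℤ ℤ.≤_) (sym (φ-∉ a b (toConfig Y) i∉S)) (+≤+ z≤n)

module _ {a n : ℕ} where

  ≗⇒sameCoset : {D E : Config n} → D ≗ E → SameCoset a D E
  ≗⇒sameCoset {D} {E} D≗E = (λ _ → 0ℤ) , 0ℤ , λ i → trans (cong (ℤ._- E i) (D≗E i)) (cancel (E i) (+ a))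
    where
    cancel : ∀ x y → x ℤ.- x ≡ y ℤ.* 0ℤ ℤ.+ 0ℤ
    cancel = ℤ-solve-∀

  sameCoset-sym : {D E : Config n} → SameCoset a D E → SameCoset a E D
  sameCoset-sym {D} {E} (x , c , D-E≡) = (λ i → ℤ.- x i) , ℤ.- c , λ i → begin
    E i ℤ.- D i                   ≡⟨ negate (D i) (E i) ⟩
    ℤ.- (D i ℤ.- E i)             ≡⟨ cong ℤ.-_ (D-E≡ i) ⟩
    ℤ.- (+ a ℤ.* x i ℤ.+ c)       ≡⟨ distrib (+ a) (x i) c ⟩
    + a ℤ.* ℤ.- x i ℤ.+ ℤ.- c     ∎
    where
    open ≡-Reasoning
    negate : ∀ d e → e ℤ.- d ≡ ℤ.- (d ℤ.- e)
    negate = ℤ-solve-∀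
    distrib : ∀ y z w → ℤ.- (y ℤ.* z ℤ.+ w) ≡ y ℤ.* ℤ.- z ℤ.+ ℤ.- w
    distrib = ℤ-solve-∀

  sameCoset-trans : {D E F : Config n} → SameCoset a D E → SameCoset a E F → SameCoset a D F
  sameCoset-trans {D} {E} {F} (x , c , D-E≡) (y , d , E-F≡) = (λ i → x i ℤ.+ y i) , c ℤ.+ d , λ i → begin
    D i ℤ.- F i                                   ≡⟨ telescope (D i) (E i) (F i) ⟩
    (D i ℤ.- E i) ℤ.+ (E i ℤ.- F i)               ≡⟨ cong₂ ℤ._+_ (D-E≡ i) (E-F≡ i) ⟩
    (+ a ℤ.* x i ℤ.+ c) ℤ.+ (+ a ℤ.* y i ℤ.+ d)   ≡⟨ collect (+ a) (x i) (y i) c d ⟩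
    + a ℤ.* (x i ℤ.+ y i) ℤ.+ (c ℤ.+ d)           ∎
    where
    open ≡-Reasoning
    telescope : ∀ d e f → d ℤ.- f ≡ (d ℤ.- e) ℤ.+ (e ℤ.- f)
    telescope = ℤ-solve-∀
    collect : ∀ z x y c d → (z ℤ.* x ℤ.+ c) ℤ.+ (z ℤ.* y ℤ.+ d) ≡ z ℤ.* (x ℤ.+ y) ℤ.+ (c ℤ.+ d)
    collect = ℤ-solve-∀

+m-+o≡+p-+n : ∀ m n o p → m + n ≡ o + p → + m ℤ.- + o ≡ + p ℤ.- + n
+m-+o≡+p-+n m n o p m+n≡o+p = begin
  + m ℤ.- + o          ≡⟨ ℤ.[+m]-[+n]≡m⊖n m o ⟩
  m ⊖ o                ≡⟨ ℤ.+-cancelˡ-⊖ n m o ⟨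
  (n + m) ⊖ (n + o)    ≡⟨ cong₂ _⊖_ (trans (+-comm n m) m+n≡o+p) (+-comm n o) ⟩
  (o + p) ⊖ (o + n)    ≡⟨ ℤ.+-cancelˡ-⊖ o p n ⟩
  p ⊖ n                ≡⟨ ℤ.[+m]-[+n]≡m⊖n p n ⟨
  + p ℤ.- + n          ∎
  where open ≡-Reasoning

congruent-reduced⇒≡ : ∀ {a u v} z → u < a → v < a → + u ≡ + v ℤ.+ + a ℤ.* z → u ≡ v
congruent-reduced⇒≡ {a} {u} {v} (+ j) u<a _ u≡v+a*j =
  u≡v+a*j⇒u≡v u<a (ℤ.+-injective (trans u≡v+a*j (cong₂ ℤ._+_ (refl {x = + v}) (sym (ℤ.pos-* a j)))))
congruent-reduced⇒≡ {a} {u} {v} -[1+ j ] _ v<a u≡v+a*z = sym (u≡v+a*j⇒u≡v v<a (ℤ.+-injective (begin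
  + v                                          ≡⟨ undo (+ v) (+ a) -[1+ j ] ⟩
  (+ v ℤ.+ + a ℤ.* -[1+ j ]) ℤ.+ + a ℤ.* + suc j ≡⟨ cong (ℤ._+ + a ℤ.* + suc j) u≡v+a*z ⟨
  + u ℤ.+ + a ℤ.* + suc j                      ≡⟨ cong₂ ℤ._+_ (refl {x = + u}) (ℤ.pos-* a (suc j)) ⟨
  + (u + a * suc j)                            ∎)))
  where
  open ≡-Reasoning
  undo : ∀ v a z → v ≡ (v ℤ.+ a ℤ.* z) ℤ.+ a ℤ.* ℤ.- z
  undo = ℤ-solve-∀

module _ {a n : ℕ} where

  sameCoset-reduce : .{{_ : NonZero a}} (D : Config n) → SameCoset a D (toConfig (λ i → D i ℤ.%ℕ a))
  sameCoset-reduce D = (λ i → D i ℤ./ℕ a) , 0ℤ , λ i → begin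
    D i ℤ.- + (D i ℤ.%ℕ a)                                         ≡⟨ cong (λ d → d ℤ.- + (D i ℤ.%ℕ a)) (a≡a%ℕn+[a/ℕn]*n (D i) a) ⟩
    (+ (D i ℤ.%ℕ a) ℤ.+ (D i ℤ./ℕ a) ℤ.* + a) ℤ.- + (D i ℤ.%ℕ a)   ≡⟨ cancel (+ (D i ℤ.%ℕ a)) (D i ℤ./ℕ a) (+ a) ⟩
    + a ℤ.* (D i ℤ./ℕ a) ℤ.+ 0ℤ                                     ∎
    where
    open ≡-Reasoning
    cancel : ∀ r q a → (r ℤ.+ q ℤ.* a) ℤ.- r ≡ a ℤ.* q ℤ.+ 0ℤ
    cancel = ℤ-solve-∀

  sameCoset-shift : ∀ {m} (Y : Fin n → ℕ) → m ≤ a → SameCoset a (toConfig Y) (toConfig (shift a m Y))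
  sameCoset-shift {m} Y m≤a = (λ i → proj₁ (entry i)) , + m , (λ i → proj₂ (entry i))
    where
    open ≡-Reasoning
    entry : ∀ i → ∃[ x ] + Y i ℤ.- + shift a m Y i ≡ + a ℤ.* x ℤ.+ + m
    entry i with <-≤-connex (Y i) m
    ... | inj₁ Yi<m = -1ℤ , (begin
      + Y i ℤ.- + shift a m Y i   ≡⟨ +m-+o≡+p-+n (Y i) a (shift a m Y i) m (sym (shift-wraps a Y i m≤a Yi<m)) ⟩
      + m ℤ.- + a                 ≡⟨ reorder (+ m) (+ a) ⟩
      + a ℤ.* -1ℤ ℤ.+ + m         ∎)
      where
      reorder : ∀ m a → m ℤ.- a ≡ a ℤ.* -1ℤ ℤ.+ m
      reorder = ℤ-solve-∀
    ... | inj₂ m≤Yi = 0ℤ , (begin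
      + Y i ℤ.- + shift a m Y i   ≡⟨ +m-+o≡+p-+n (Y i) 0 (shift a m Y i) m (trans (+-identityʳ (Y i)) (sym (shift-drops a Y i m≤Yi))) ⟩
      + m ℤ.- 0ℤ                  ≡⟨ reorder (+ m) (+ a) ⟩
      + a ℤ.* 0ℤ ℤ.+ + m          ∎)
      where
      reorder : ∀ m a → m ℤ.- 0ℤ ≡ a ℤ.* 0ℤ ℤ.+ m
      reorder = ℤ-solve-∀

  sameCoset⇒shift : .{{_ : NonZero a}} {X Y : Fin n → ℕ} → Reduced a X → Reduced a Y →
                    SameCoset a (toConfig X) (toConfig Y) → ∃[ m ] m < a × X ≗ shift a m Y
  sameCoset⇒shift {X} {Y} reducedX reducedY X~Y@(_ , c , _) = m , m<a , X≗shift
    where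
    open ≡-Reasoning
    m = ℤ.- c ℤ.%ℕ a
    q = ℤ.- c ℤ./ℕ a
    m<a : m < a
    m<a = n%ℕd<d (ℤ.- c) a
    -- m is chosen so that the constant c + m relating X to shift a m Y is a multiple of a.
    c+m≡a*[-q] : c ℤ.+ + m ≡ + a ℤ.* ℤ.- q
    c+m≡a*[-q] = begin
      c ℤ.+ + m                         ≡⟨ cong (λ d → d ℤ.+ + m) (ℤ.neg-involutive c) ⟨
      ℤ.- (ℤ.- c) ℤ.+ + m               ≡⟨ cong (λ d → ℤ.- d ℤ.+ + m) (a≡a%ℕn+[a/ℕn]*n (ℤ.- c) a) ⟩
      ℤ.- (+ m ℤ.+ q ℤ.* + a) ℤ.+ + m   ≡⟨ cancel (+ m) q (+ a) ⟩
      + a ℤ.* ℤ.- q                     ∎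
      where
      cancel : ∀ m q a → ℤ.- (m ℤ.+ q ℤ.* a) ℤ.+ m ≡ a ℤ.* ℤ.- q
      cancel = ℤ-solve-∀
    X~shift : SameCoset a (toConfig X) (toConfig (shift a m Y))
    X~shift = sameCoset-trans {a = a} {D = toConfig X} {toConfig Y} {toConfig (shift a m Y)} X~Y (sameCoset-shift Y (<⇒≤ m<a))
    x = proj₁ X~shift
    X≗shift : X ≗ shift a m Y
    X≗shift i = congruent-reduced⇒≡ (x i ℤ.- q) (reducedX i) (shift-reduced a (<⇒≤ m<a) reducedY i) (begin
      + X i                                             ≡⟨ split (+ X i) S ⟩
      S ℤ.+ (+ X i ℤ.- S)                               ≡⟨ cong₂ ℤ._+_ (refl {x = S}) (proj₂ (proj₂ X~shift) i) ⟩
      S ℤ.+ (+ a ℤ.* x i ℤ.+ (c ℤ.+ + m))               ≡⟨ cong (λ d → S ℤ.+ (+ a ℤ.* x i ℤ.+ d)) c+m≡a*[-q] ⟩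
      S ℤ.+ (+ a ℤ.* x i ℤ.+ + a ℤ.* ℤ.- q)             ≡⟨ collect S (+ a) (x i) q ⟩
      S ℤ.+ + a ℤ.* (x i ℤ.- q)                         ∎)
      where
      S = + shift a m Y i
      split : ∀ x s → x ≡ s ℤ.+ (x ℤ.- s)
      split = ℤ-solve-∀
      collect : ∀ s a x q → s ℤ.+ (a ℤ.* x ℤ.+ a ℤ.* ℤ.- q) ≡ s ℤ.+ a ℤ.* (x ℤ.- q)
      collect = ℤ-solve-∀

module _ {a b : ℕ} .{{_ : NonZero b}} (coprime : Coprime a b) where

  sameCoset-β : ∀ {T D} → 0 < ∣ T ∣ → SameCoset a (β a b T D) D
  sameCoset-β {T} {D} 0<t = (λ i → proj₁ (entry i)) , + L , (λ i → proj₂ (entry i))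
    where
    open ≡-Reasoning
    L = loss a b ∣ T ∣
    G = gain a b ∣ T ∣
    entry : ∀ i → ∃[ x ] β a b T D i ℤ.- D i ≡ + a ℤ.* x ℤ.+ + L
    entry i with i ∈? T
    ... | yes i∈T = 0ℤ , (begin
      β a b T D i ℤ.- D i         ≡⟨ cong (λ d → d ℤ.- D i) (β-∈ a b D i∈T) ⟩
      (D i ℤ.+ + L) ℤ.- D i       ≡⟨ cancel (D i) (+ L) (+ a) ⟩
      + a ℤ.* 0ℤ ℤ.+ + L          ∎)
      where
      cancel : ∀ d l a → (d ℤ.+ l) ℤ.- d ≡ a ℤ.* 0ℤ ℤ.+ l
      cancel = ℤ-solve-∀
    ... | no i∉T = -1ℤ , (begin
      β a b T D i ℤ.- D i           ≡⟨ cong (λ d → d ℤ.- D i) (β-∉ a b D i∉T) ⟩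
      (D i ℤ.- + G) ℤ.- D i         ≡⟨ cancel (D i) (+ L) (+ G) ⟩
      (+ L ℤ.+ + G) ℤ.* -1ℤ ℤ.+ + L  ≡⟨ cong (λ x → + x ℤ.* -1ℤ ℤ.+ + L) (loss+gain≡a coprime 0<t (x∉p⇒∣p∣<n i∉T)) ⟩
      + a ℤ.* -1ℤ ℤ.+ + L           ∎)
      where
      cancel : ∀ d l g → (d ℤ.- g) ℤ.- d ≡ (l ℤ.+ g) ℤ.* -1ℤ ℤ.+ l
      cancel = ℤ-solve-∀

-- Heaviest stable configurations

module _ (a b k : ℕ) .{{_ : NonZero b}} where

  Heaviest : (Fin b → ℕ) → Set
  Heaviest E = Stable a b k E × (∀ X → Stable a b k X → SameCoset a (toConfig X) (toConfig E) → sum X ≤ sum E)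

module _ {a b k : ℕ} .{{_ : NonZero b}} (0<a : 0 < a) (coprime : Coprime a b) (k<b : k < b) where

  private instance
    nonZero-a : NonZero a
    nonZero-a = >-nonZero 0<a

  lighter-shift-reverse-fires : ∀ {E m₀} → Stable a b k E → 0 < m₀ → m₀ < a → sum (shift a m₀ E) ≤ sum E →
    ∃[ T ] 0 < ∣ T ∣ × ∃[ V ] Stable a b k V × ReverseFiring a b T (shift a m₀ E) V
  lighter-shift-reverse-fires {E} {m₀} stableE 0<m₀ m₀<a lighter =
    let m , m<m₀ , minimal , heavier , close =
          prefix-minimal-shift-above a E (<⇒≤ m₀<a) (≤∧≢⇒< lighter (sum-shift≢sum coprime E 0<m₀ m₀<a))
        T , 0<∣T∣ , firing = reverse-firing-between coprime (shift a m₀ E) (shift a m E)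
          (m<n⇒0<n∸m m<m₀) (≤-trans (m∸n≤m m₀ m) (<⇒≤ m₀<a)) (λ i → shift-compare a E i (<⇒≤ m<m₀) (<⇒≤ m₀<a)) heavier close
    in T , 0<∣T∣ , shift a m E , prefix-minimal-shift-stable 0<a k<b stableE (<⇒≤ (<-trans m<m₀ m₀<a)) minimal , firing

  heaviest-stable-shift⇒Heaviest : ∀ {m} {B : Fin b → ℕ} → Reduced a B → m ≤ a → Stable a b k (shift a m B) →
    (∀ {z} → z < a → Stable a b k (shift a z B) → sum (shift a z B) ≤ sum (shift a m B)) → Heaviest a b k (shift a m B)
  heaviest-stable-shift⇒Heaviest {m} {B} reducedB m≤a stable heaviest-among = stable , λ X stableX X~E →
    let z , z<a , X≗shift = sameCoset⇒shift (stable⇒reduced 0<a k<b stableX) reducedB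
          (sameCoset-trans {a = a} {D = toConfig X} {toConfig (shift a m B)} {toConfig B} X~E
            (sameCoset-sym {a = a} {D = toConfig B} {toConfig (shift a m B)} (sameCoset-shift B m≤a)))
    in ≤-trans (≤-reflexive (sum-cong-≗ X≗shift)) (heaviest-among z<a (stable-resp-≗ X≗shift stableX))

  heaviest-shift-exists : ∀ (B : Fin b → ℕ) → Reduced a B → ∃[ m ] m ≤ a × Heaviest a b k (shift a m B)
  heaviest-shift-exists B reducedB =
    let m₁ , m₁≤a , lightest = argmin-upTo w a
        m , (m≤a , stable) , heaviest-among =
          argmax-upTo w candidate? a (m₁≤a , minimal-shift-stable 0<a k<b B reducedB m₁≤a lightest)
    in m , m≤a , heaviest-stable-shift⇒Heaviest reducedB m≤a stable λ z<a stableZ → heaviest-among z<a (<⇒≤ z<a , stableZ)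
    where
    w : ℕ → ℕ
    w z = sum (shift a z B)
    candidate? : ∀ z → Dec (z ≤ a × Stable a b k (shift a z B))
    candidate? z = z ≤? a ×-dec stable? a b k (shift a z B)

  heaviest-exists : ∀ D → ∃[ E ] Heaviest a b k E × SameCoset a D (toConfig E)
  heaviest-exists D =
    let m , m≤a , heaviest = heaviest-shift-exists B (λ i → n%ℕd<d (D i) a)
    in shift a m B , heaviest , sameCoset-trans {a = a} {D = D} {toConfig B} {toConfig (shift a m B)} (sameCoset-reduce D) (sameCoset-shift B m≤a)
    where
    B : Fin b → ℕ
    B i = D i ℤ.%ℕ a

  heaviest⇒kSkeletal : ∀ {E} → Heaviest a b k E → kSkeletal a b k (toConfig E)
  heaviest⇒kSkeletal {E} (stableE , heaviest) = stable⇒kStable stableE , no-stable-reverse-firing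
    where
    no-stable-reverse-firing : ∀ T → 0 < ∣ T ∣ → NonNeg (β a b T (toConfig E)) → ¬ kStable a b k (β a b T (toConfig E))
    no-stable-reverse-firing T 0<∣T∣ nonNeg kStableβ =
      <⇒≱ (reverse-firing-heavier coprime {T} 0<∣T∣ (β≗⇒ReverseFiring β≗Z)) (heaviest Z (kStable⇒stable (kStable-resp-≗ β≗Z kStableβ)) Z~E)
      where
      Z : Fin b → ℕ
      Z i = ℤ.∣ β a b T (toConfig E) i ∣
      β≗Z : β a b T (toConfig E) ≗ toConfig Z
      β≗Z = nonNeg⇒≗toConfig nonNeg
      Z~E : SameCoset a (toConfig Z) (toConfig E)
      Z~E = sameCoset-trans {a = a} {D = toConfig Z} {β a b T (toConfig E)} {toConfig E}
              (≗⇒sameCoset {a = a} (λ i → sym (β≗Z i))) (sameCoset-β coprime {T} {toConfig E} 0<∣T∣)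

  kSkeletal-unique : ∀ {E E′} → Heaviest a b k E → kSkeletal a b k E′ → SameCoset a E′ (toConfig E) → E′ ≗ toConfig E
  kSkeletal-unique {E} {E′} (stableE , heaviest) (kStableE′ , no-stable-reverse-firing) E′~E =
    settle (sameCoset⇒shift (stable⇒reduced 0<a k<b stableX) (stable⇒reduced 0<a k<b stableE) X~E)
    where
    X : Fin b → ℕ
    X i = ℤ.∣ E′ i ∣
    E′≗X : E′ ≗ toConfig X
    E′≗X = nonNeg⇒≗toConfig (proj₁ kStableE′)
    stableX : Stable a b k X
    stableX = kStable⇒stable (kStable-resp-≗ E′≗X kStableE′)
    X~E : SameCoset a (toConfig X) (toConfig E)
    X~E = sameCoset-trans {a = a} {D = toConfig X} {E′} {toConfig E} (≗⇒sameCoset {a = a} (λ i → sym (E′≗X i))) E′~E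
    settle : (∃[ m ] m < a × X ≗ shift a m E) → E′ ≗ toConfig E
    settle (zero , _ , X≗E) i = trans (E′≗X i) (cong +_ (X≗E i))
    settle (suc m , 1+m<a , X≗shift) = ⊥-elim (refute
      (lighter-shift-reverse-fires stableE z<s 1+m<a (subst (_≤ sum E) (sum-cong-≗ X≗shift) (heaviest X stableX X~E))))
      where
      E′≗shift : E′ ≗ toConfig (shift a (suc m) E)
      E′≗shift i = trans (E′≗X i) (cong +_ (X≗shift i))
      refute : ¬ (∃[ T ] 0 < ∣ T ∣ × ∃[ V ] Stable a b k V × ReverseFiring a b T (shift a (suc m) E) V)
      refute (T , 0<∣T∣ , V , stableV , firing) =
        no-stable-reverse-firing T 0<∣T∣ (λ i → subst (0ℤ ℤ.≤_) (V≗β i) (+≤+ z≤n)) (kStable-resp-≗ V≗β (stable⇒kStable stableV))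
        where
        V≗β : toConfig V ≗ β a b T E′
        V≗β i = sym (trans (β-cong a b T E′≗shift i) (ReverseFiring⇒β≗ firing i))

lemma5p4 : (a b : ℕ) .{{_ : NonZero b}} → 0 < a → Coprime a b →
    (k : ℕ) → k < b →
    (D : Config b) →
    Σ (Config b) λ E → (kSkeletal a b k E × SameCoset a D E) ×
      (∀ (E′ : Config b) → kSkeletal a b k E′ → SameCoset a D E′ → ∀ i → E′ i ≡ E i)
lemma5p4 a b 0<a coprime k k<b D =
  let E , heaviestE , D~E = heaviest-exists 0<a coprime k<b D
  in toConfig E , (heaviest⇒kSkeletal 0<a coprime k<b heaviestE , D~E) , λ E′ skeletalE′ D~E′ →
       kSkeletal-unique 0<a coprime k<b heaviestE skeletalE′
         (sameCoset-trans {a = a} {D = E′} {D} {toConfig E} (sameCoset-sym {a = a} {D = D} {E′} D~E′) D~E)
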